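{- A finite simple graph $G$ has pegging number $P(G)=3$ if and only if either $G$ is isomorphic to $3K_1$, or $\alpha(G)=2$ and the following condition $(\ast)$ fails: $(\ast)$: $G$ is spanned by $C\cup D$ where $C$ and $D$ are complete subgraphs of $G$ (i.e. $V(G)=V(C)\cup V(D)$), and either $G$ is isomorphic to $2K_1$ or $2K_2$, or $G$ has vertices $t \in C$ and $v_1,v_2,v_3 \in D$ such that $t$ is not adjacent to any vertex of $D$ and every vertex of $C$ is adjacent to at most one of $v_1,v_2,v_3$.
   Context: $kK_1$ denotes $k$ isolated vertices and $2K_2$ the disjoint union of two edges. $\alpha(G)$ is the independence number. A distribution of pegs on $G$ is a subset $D \subseteq V(G)$. If $u,v \in D$ are distinct adjacent vertices and $w \notin D$ is a vertex adjacent to $v$, the pegging move (jumping $u$ over $v$ into $w$) replaces $D$ by $(D\setminus\{u,v\})\cup\{w\}$. A vertex $t$ is reachable from $D$ if some finite (possibly empty) sequence of pegging moves starting from $D$ ends in a distribution containing $t$; $\mathrm{Reach}(D)$ is the set of reachable vertices. The pegging number $P(G)$ is the smallest positive integer $d$ such that every distribution of size $d$ on $G$ has reach $V(G)$. -}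

module Defs where

open import Data.Nat using (ℕ; zero; suc; _<_; _≤_)
open import Data.Bool using (Bool; true; false)
open import Data.Fin using (Fin; zero; suc)
open import Data.Fin.Subset using (Subset; _∈_; _∉_; ∣_∣; _∪_; ⊤; inside; outside)
open import Data.Vec using (_[_]≔_)
open import Data.Product using (Σ; ∃; _×_; _,_)
open import Data.Sum using (_⊎_)
open import Relation.Nullary using (¬_)
open import Relation.Binary.PropositionalEquality using (_≡_; _≢_)
open import Relation.Binary.Construct.Closure.ReflexiveTransitive using (Star)
open import Function.Bundles using (_↔_; Inverse)

record Graph (n : ℕ) : Set where
  field
    adj    : Fin n → Fin n → Bool
    sym    : ∀ u v → adj u v ≡ adj v u
    irrefl : ∀ v → adj v v ≡ false
open Graph public

Adj : ∀ {n} → Graph n → Fin n → Fin n → Set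
Adj G u v = adj G u v ≡ true

_≅_ : ∀ {n m} → Graph n → Graph m → Set
_≅_ {n} {m} G H =
  Σ (Fin n ↔ Fin m) λ f →
    ∀ u v → adj G u v ≡ adj H (Inverse.to f u) (Inverse.to f v)

emptyGraph : (k : ℕ) → Graph k
emptyGraph k = record { adj = λ _ _ → false ; sym = λ _ _ → _≡_.refl ; irrefl = λ _ → _≡_.refl }

3K₁ : Graph 3
3K₁ = emptyGraph 3

2K₁ : Graph 2
2K₁ = emptyGraph 2

2K₂-adj : Fin 4 → Fin 4 → Bool
2K₂-adj zero (suc zero) = true
2K₂-adj (suc zero) zero = true
2K₂-adj (suc (suc zero)) (suc (suc (suc zero))) = true
2K₂-adj (suc (suc (suc zero))) (suc (suc zero)) = true
2K₂-adj _ _ = false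

2K₂ : Graph 4
2K₂ = record { adj = 2K₂-adj ; sym = s ; irrefl = i }
  where
  s : ∀ u v → 2K₂-adj u v ≡ 2K₂-adj v u
  s zero zero = _≡_.refl
  s zero (suc zero) = _≡_.refl
  s zero (suc (suc zero)) = _≡_.refl
  s zero (suc (suc (suc zero))) = _≡_.refl
  s (suc zero) zero = _≡_.refl
  s (suc zero) (suc zero) = _≡_.refl
  s (suc zero) (suc (suc zero)) = _≡_.refl
  s (suc zero) (suc (suc (suc zero))) = _≡_.refl
  s (suc (suc zero)) zero = _≡_.refl
  s (suc (suc zero)) (suc zero) = _≡_.refl
  s (suc (suc zero)) (suc (suc zero)) = _≡_.refl
  s (suc (suc zero)) (suc (suc (suc zero))) = _≡_.refl
  s (suc (suc (suc zero))) zero = _≡_.refl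
  s (suc (suc (suc zero))) (suc zero) = _≡_.refl
  s (suc (suc (suc zero))) (suc (suc zero)) = _≡_.refl
  s (suc (suc (suc zero))) (suc (suc (suc zero))) = _≡_.refl
  i : ∀ v → 2K₂-adj v v ≡ false
  i zero = _≡_.refl
  i (suc zero) = _≡_.refl
  i (suc (suc zero)) = _≡_.refl
  i (suc (suc (suc zero))) = _≡_.refl

Independent : ∀ {n} → Graph n → Subset n → Set
Independent G S = ∀ u v → u ∈ S → v ∈ S → ¬ Adj G u v

IndependenceNumberIs : ∀ {n} → Graph n → ℕ → Set
IndependenceNumberIs {n} G k =
  (Σ (Subset n) λ S → Independent G S × ∣ S ∣ ≡ k) ×
  (∀ S → Independent G S → ∣ S ∣ ≤ k)

PegMove : ∀ {n} → Graph n → Subset n → Subset n → Set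
PegMove {n} G D D′ =
  Σ (Fin n) λ u → Σ (Fin n) λ v → Σ (Fin n) λ w →
    u ≢ v × u ∈ D × v ∈ D × Adj G u v × w ∉ D × Adj G v w ×
    D′ ≡ ((D [ u ]≔ outside) [ v ]≔ outside) [ w ]≔ inside

Reachable : ∀ {n} → Graph n → Subset n → Fin n → Set
Reachable {n} G D t = Σ (Subset n) λ D′ → Star (PegMove G) D D′ × t ∈ D′

AllReach : ∀ {n} → Graph n → ℕ → Set
AllReach {n} G d = ∀ (D : Subset n) → ∣ D ∣ ≡ d → ∀ t → Reachable G D t

PeggingNumberIs : ∀ {n} → Graph n → ℕ → Set
PeggingNumberIs G d =
  0 < d × AllReach G d × (∀ d′ → 0 < d′ → d′ < d → ¬ AllReach G d′)

Clique : ∀ {n} → Graph n → Subset n → Set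
Clique G C = ∀ u v → u ∈ C → v ∈ C → u ≢ v → Adj G u v

AtMostOneAdj : ∀ {n} → Graph n → Fin n → Fin n → Fin n → Fin n → Set
AtMostOneAdj G c v₁ v₂ v₃ =
  ¬ (Adj G c v₁ × Adj G c v₂) ×
  ¬ (Adj G c v₁ × Adj G c v₃) ×
  ¬ (Adj G c v₂ × Adj G c v₃)

ConditionStar : ∀ {n} → Graph n → Set
ConditionStar {n} G =
  Σ (Subset n) λ C → Σ (Subset n) λ D →
    Clique G C × Clique G D × (C ∪ D ≡ ⊤) ×
    ( G ≅ 2K₁ ⊎ G ≅ 2K₂ ⊎
      ( Σ (Fin n) λ t → Σ (Fin n) λ v₁ → Σ (Fin n) λ v₂ → Σ (Fin n) λ v₃ →
          t ∈ C × v₁ ∈ D × v₂ ∈ D × v₃ ∈ D ×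
          v₁ ≢ v₂ × v₁ ≢ v₃ × v₂ ≢ v₃ ×
          (∀ x → x ∈ D → ¬ Adj G t x) ×
          (∀ c → c ∈ C → AtMostOneAdj G c v₁ v₂ v₃)))

-- Two pegs reach every vertex of a complete graph and of 2K₁, while pegs that are pairwise
-- non-adjacent cannot move at all. Hence P(G) = 3 forces α(G) = 2, unless an independent
-- triple already occupies every vertex, i.e. G ≅ 3K₁. When α(G) ≤ 2, three pegs always
-- contain an edge ab, and a target t adjacent to neither a nor b is reached in at most two
-- jumps through a fresh vertex; when this fails, the closed neighbourhood of t (if t sees none
-- of the pegs) or of the third peg c (if t sees only c), together with its complement, are two
-- cliques witnessing (∗). Conversely each case of (∗) has three pegs that miss some vertex: in
-- 2K₂ nothing can jump, and in the last case three pegs allow only two jumps, the second of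
-- which would have to go over a vertex of C adjacent to two of v₁, v₂, v₃.
module Submission where

open import Defs hiding (sym; irrefl)
open import Data.Bool using (true; false) renaming (_≟_ to _≟ᵇ_)
open import Data.Bool.Properties using (¬-not)
open import Data.Empty using (⊥-elim)
open import Data.Fin using (Fin; zero; suc)
open import Data.Fin.Permutation using (↔⇒≡)
open import Data.Fin.Properties using (_≟_; any?)
import Data.Fin.Subset as Subset
open import Data.Fin.Subset using (Subset; _∈_; _∉_; _⊆_; ∣_∣; _∪_; ⊤; ⊥; ∁; inside; outside)
open import Data.Fin.Subset.Properties
  using (_∈?_; ∈⊤; ∉⊥; ⊆⊤; ⊆-antisym; ∣⊤∣≡n; ∣⊥∣≡0; ∣p∣≡n⇒p≡⊤; Empty-unique; nonempty?;
         x∈⁅x⁆; x∈⁅y⁆⇒x≡y; ∣⁅x⁆∣≡1; p∪∁p≡⊤; ∪-comm; x∈∁p⇒x∉p; x∉p⇒x∈∁p; x∈p∪q⁻; x∈p∪q⁺)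
open import Data.Nat using (ℕ; suc; _+_; _<_; _≤_; z≤n; s≤s)
open import Data.Nat.Properties using (suc-injective; ≤-refl)
open import Data.Product using (∃-syntax; _×_; _,_; proj₁; proj₂)
open import Data.Sum using (_⊎_; inj₁; inj₂; [_,_]′)
open import Data.Vec using (_∷_; _[_]≔_; tabulate; here; there)
open import Data.Vec.Properties
  using (lookup∘tabulate; []=⇒lookup; lookup⇒[]=; lookup∘update′; []≔-updates; []≔-minimal;
         []=-injective; []≔-commutes)
open import Function.Base using (id; _∘_)
open import Function.Bundles using (Inverse; mk↔ₛ′; _⇔_; mk⇔)
open import Relation.Binary.Construct.Closure.ReflexiveTransitive using (ε; _◅_)
open import Relation.Binary.PropositionalEquality
  using (_≡_; _≢_; refl; sym; ≢-sym; trans; cong; cong₂; subst; module ≡-Reasoning)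
open import Relation.Nullary using (¬_; Dec; yes; no; does; ¬?)
open import Relation.Nullary.Decidable using (_×-dec_; _⊎-dec_)

private variable
  n m k : ℕ

module _ {p : Subset n} where

  ∈-insert : ∀ x → x ∈ p [ x ]≔ inside
  ∈-insert x = []≔-updates p x

  ∉-remove : ∀ x → x ∉ p [ x ]≔ outside
  ∉-remove x x∈ with []=-injective x∈ ([]≔-updates p x)
  ... | ()

  ∈-update⁺ : ∀ {x y b} → y ≢ x → y ∈ p → y ∈ p [ x ]≔ b
  ∈-update⁺ {x} {y} y≢x = []≔-minimal p y x y≢x

  ∈-update⁻ : ∀ {x y b} → y ≢ x → y ∈ p [ x ]≔ b → y ∈ p
  ∈-update⁻ {x} {y} {b} y≢x y∈ =
    lookup⇒[]= y p (trans (sym (lookup∘update′ y≢x p b)) ([]=⇒lookup y∈))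

  ∈-insert⁺ : ∀ {x y} → y ∈ p → y ∈ p [ x ]≔ inside
  ∈-insert⁺ {x} {y} y∈ with y ≟ x
  ... | yes refl = ∈-insert y
  ... | no y≢x = ∈-update⁺ y≢x y∈

  ∈-insert⁻ : ∀ {x y} → y ∈ p [ x ]≔ inside → y ≡ x ⊎ y ∈ p
  ∈-insert⁻ {x} {y} y∈ with y ≟ x
  ... | yes y≡x = inj₁ y≡x
  ... | no y≢x = inj₂ (∈-update⁻ y≢x y∈)

  ∈-remove⁻ : ∀ {x y} → y ∈ p [ x ]≔ outside → y ≢ x × y ∈ p
  ∈-remove⁻ {x} {y} y∈ with y ≟ x
  ... | yes refl = ⊥-elim (∉-remove y y∈)
  ... | no y≢x = y≢x , ∈-update⁻ y≢x y∈

∈∉⇒≢ : ∀ {p : Subset n} {x y} → x ∈ p → y ∉ p → x ≢ y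
∈∉⇒≢ x∈ y∉ refl = y∉ x∈

¬∃≢⇒≡⊎≡ : ∀ {P : Fin n → Set} {a b} → ¬ (∃[ x ] P x × x ≢ a × x ≢ b) → ∀ {x} → P x → x ≡ a ⊎ x ≡ b
¬∃≢⇒≡⊎≡ {a = a} {b} none {x} px with x ≟ a | x ≟ b
... | yes x≡a | _ = inj₁ x≡a
... | no _ | yes x≡b = inj₂ x≡b
... | no x≢a | no x≢b = ⊥-elim (none (x , px , x≢a , x≢b))

∣insert∣ : ∀ (p : Subset n) {x} → x ∉ p → ∣ p [ x ]≔ inside ∣ ≡ suc ∣ p ∣
∣insert∣ (false ∷ p) {zero}  x∉ = refl
∣insert∣ (true  ∷ p) {zero}  x∉ = ⊥-elim (x∉ here)
∣insert∣ (false ∷ p) {suc x} x∉ = ∣insert∣ p (λ x∈ → x∉ (there x∈))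
∣insert∣ (true  ∷ p) {suc x} x∉ = cong suc (∣insert∣ p (λ x∈ → x∉ (there x∈)))

∣remove∣ : ∀ (p : Subset n) {x} → x ∈ p → ∣ p ∣ ≡ suc ∣ p [ x ]≔ outside ∣
∣remove∣ (true  ∷ p) here       = refl
∣remove∣ (false ∷ p) (there x∈) = ∣remove∣ p x∈
∣remove∣ (true  ∷ p) (there x∈) = cong suc (∣remove∣ p x∈)

∣p∣≡0⇒x∉p : ∀ {p : Subset n} {x} → ∣ p ∣ ≡ 0 → x ∉ p
∣p∣≡0⇒x∉p {p = p} ∣p∣≡0 x∈ with trans (sym ∣p∣≡0) (∣remove∣ p x∈)
... | ()

∣p∣≡0⇒p≡⊥ : ∀ {p : Subset n} → ∣ p ∣ ≡ 0 → p ≡ ⊥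
∣p∣≡0⇒p≡⊥ ∣p∣≡0 = Empty-unique (λ (x , x∈) → ∣p∣≡0⇒x∉p ∣p∣≡0 x∈)

∣p∣≡suc⇒insert : ∀ {n k} {p : Subset n} → ∣ p ∣ ≡ suc k →
  ∃[ x ] ∃[ q ] x ∉ q × ∣ q ∣ ≡ k × p ≡ q [ x ]≔ inside
∣p∣≡suc⇒insert {n} {p = p} ∣p∣≡1+k with nonempty? p
... | no empty with trans (sym ∣p∣≡1+k) (trans (cong ∣_∣ (Empty-unique empty)) (∣⊥∣≡0 n))
...   | ()
∣p∣≡suc⇒insert {n} {p = p} ∣p∣≡1+k | yes (x , x∈) = x , p [ x ]≔ outside , ∉-remove x ,
  suc-injective (trans (sym (∣remove∣ p x∈)) ∣p∣≡1+k) , ⊆-antisym ⊆-reinsert reinsert-⊆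
  where
  ⊆-reinsert : p ⊆ p [ x ]≔ outside [ x ]≔ inside
  ⊆-reinsert {y} y∈ with y ≟ x
  ... | yes refl = ∈-insert y
  ... | no y≢x = ∈-update⁺ y≢x (∈-update⁺ y≢x y∈)
  reinsert-⊆ : p [ x ]≔ outside [ x ]≔ inside ⊆ p
  reinsert-⊆ y∈ with ∈-insert⁻ y∈
  ... | inj₁ refl = x∈
  ... | inj₂ y∈′ = proj₂ (∈-remove⁻ y∈′)

∣p∣≡2+k⇒ : ∀ {p : Subset n} → ∣ p ∣ ≡ 2 + k →
  ∃[ a ] ∃[ b ] ∃[ r ] a ≢ b × ∣ r ∣ ≡ k × p ≡ r [ a ]≔ inside [ b ]≔ inside
∣p∣≡2+k⇒ {p = p} ∣p∣≡2+k with ∣p∣≡suc⇒insert {p = p} ∣p∣≡2+k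
... | b , q , b∉q , ∣q∣≡1+k , refl with ∣p∣≡suc⇒insert {p = q} ∣q∣≡1+k
...   | a , r , a∉r , ∣r∣≡k , refl = a , b , r , ∈∉⇒≢ (∈-insert a) b∉q , ∣r∣≡k , refl

∣p∣≡3+k⇒ : ∀ {p : Subset n} → ∣ p ∣ ≡ 3 + k →
  ∃[ a ] ∃[ b ] ∃[ c ] ∃[ r ] a ≢ b × a ≢ c × b ≢ c × ∣ r ∣ ≡ k ×
    p ≡ r [ a ]≔ inside [ b ]≔ inside [ c ]≔ inside
∣p∣≡3+k⇒ {p = p} ∣p∣≡3+k with ∣p∣≡suc⇒insert {p = p} ∣p∣≡3+k
... | c , q , c∉q , ∣q∣≡2+k , refl with ∣p∣≡2+k⇒ {p = q} ∣q∣≡2+k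
...   | a , b , r , a≢b , ∣r∣≡k , refl =
  a , b , c , r , a≢b , ∈∉⇒≢ (∈-insert⁺ (∈-insert a)) c∉q , ∈∉⇒≢ (∈-insert b) c∉q , ∣r∣≡k , refl

⟅_,_⟆ : Fin n → Fin n → Subset n
⟅ a , b ⟆ = ⊥ [ a ]≔ inside [ b ]≔ inside

⁅_,_,_⁆ : Fin n → Fin n → Fin n → Subset n
⁅ a , b , c ⁆ = ⟅ a , b ⟆ [ c ]≔ inside

module _ {a b : Fin n} where

  ∈⟅,⟆⁻ : ∀ {x} → x ∈ ⟅ a , b ⟆ → x ≡ a ⊎ x ≡ b
  ∈⟅,⟆⁻ x∈ with ∈-insert⁻ x∈
  ... | inj₁ x≡b = inj₂ x≡b
  ... | inj₂ x∈′ with ∈-insert⁻ x∈′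
  ...   | inj₁ x≡a = inj₁ x≡a
  ...   | inj₂ x∈⊥ = ⊥-elim (∉⊥ x∈⊥)

  ∉⟅,⟆ : ∀ {w} → w ≢ a → w ≢ b → w ∉ ⟅ a , b ⟆
  ∉⟅,⟆ w≢a w≢b w∈ = [ w≢a , w≢b ]′ (∈⟅,⟆⁻ w∈)

  ∣⟅,⟆∣ : a ≢ b → ∣ ⟅ a , b ⟆ ∣ ≡ 2
  ∣⟅,⟆∣ a≢b = trans (∣insert∣ _ b∉) (cong suc (trans (∣insert∣ (⊥ {n}) ∉⊥) (cong suc (∣⊥∣≡0 n))))
    where
    b∉ : b ∉ ⊥ [ a ]≔ inside
    b∉ b∈ with ∈-insert⁻ b∈
    ... | inj₁ b≡a = a≢b (sym b≡a)
    ... | inj₂ b∈⊥ = ∉⊥ b∈⊥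

module _ {a b c : Fin n} where

  ∈⁅,,⁆⁻ : ∀ {x} → x ∈ ⁅ a , b , c ⁆ → x ≡ a ⊎ x ≡ b ⊎ x ≡ c
  ∈⁅,,⁆⁻ x∈ with ∈-insert⁻ x∈
  ... | inj₁ x≡c = inj₂ (inj₂ x≡c)
  ... | inj₂ x∈′ with ∈⟅,⟆⁻ x∈′
  ...   | inj₁ x≡a = inj₁ x≡a
  ...   | inj₂ x≡b = inj₂ (inj₁ x≡b)

  a∈⁅,,⁆ : a ∈ ⁅ a , b , c ⁆
  a∈⁅,,⁆ = ∈-insert⁺ (∈-insert⁺ (∈-insert a))

  b∈⁅,,⁆ : b ∈ ⁅ a , b , c ⁆
  b∈⁅,,⁆ = ∈-insert⁺ (∈-insert b)

  c∈⁅,,⁆ : c ∈ ⁅ a , b , c ⁆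
  c∈⁅,,⁆ = ∈-insert c

  ∉⁅,,⁆ : ∀ {w} → w ≢ a → w ≢ b → w ≢ c → w ∉ ⁅ a , b , c ⁆
  ∉⁅,,⁆ w≢a w≢b w≢c w∈ with ∈⁅,,⁆⁻ w∈
  ... | inj₁ w≡a = w≢a w≡a
  ... | inj₂ (inj₁ w≡b) = w≢b w≡b
  ... | inj₂ (inj₂ w≡c) = w≢c w≡c

  ∣⁅,,⁆∣ : a ≢ b → a ≢ c → b ≢ c → ∣ ⁅ a , b , c ⁆ ∣ ≡ 3
  ∣⁅,,⁆∣ a≢b a≢c b≢c = trans (∣insert∣ _ (∉⟅,⟆ (≢-sym a≢c) (≢-sym b≢c))) (cong suc (∣⟅,⟆∣ a≢b))

  ⁅,,⁆-swap₂₃ : b ≢ c → ⁅ a , b , c ⁆ ≡ ⁅ a , c , b ⁆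
  ⁅,,⁆-swap₂₃ b≢c = []≔-commutes (⊥ [ a ]≔ inside) b c b≢c

  ⁅,,⁆-rotate : a ≢ b → a ≢ c → ⁅ a , b , c ⁆ ≡ ⁅ b , c , a ⁆
  ⁅,,⁆-rotate a≢b a≢c = begin
    ⁅ a , b , c ⁆ ≡⟨ cong (_[ c ]≔ inside) ([]≔-commutes ⊥ a b a≢b) ⟩
    ⁅ b , a , c ⁆ ≡⟨ []≔-commutes (⊥ [ b ]≔ inside) a c a≢c ⟩
    ⁅ b , c , a ⁆ ∎
    where open ≡-Reasoning

∣p∣≡3⇒⁅,,⁆ : ∀ {p : Subset n} → ∣ p ∣ ≡ 3 →
  ∃[ a ] ∃[ b ] ∃[ c ] a ≢ b × a ≢ c × b ≢ c × p ≡ ⁅ a , b , c ⁆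
∣p∣≡3⇒⁅,,⁆ {p = p} ∣p∣≡3 with ∣p∣≡3+k⇒ {p = p} ∣p∣≡3
... | a , b , c , r , a≢b , a≢c , b≢c , ∣r∣≡0 , refl with ∣p∣≡0⇒p≡⊥ {p = r} ∣r∣≡0
...   | refl = a , b , c , a≢b , a≢c , b≢c , refl

⟦_⟧ : {P : Fin n → Set} → (∀ x → Dec (P x)) → Subset n
⟦ P? ⟧ = tabulate (λ x → does (P? x))

module _ {P : Fin n → Set} (P? : ∀ x → Dec (P x)) {x : Fin n} where

  ∈⟦⟧⁺ : P x → x ∈ ⟦ P? ⟧
  ∈⟦⟧⁺ px with P? x | lookup∘tabulate (λ x → does (P? x)) x
  ... | yes _ | lookup≡true = lookup⇒[]= x _ lookup≡true
  ... | no ¬px | _ = ⊥-elim (¬px px)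

  ∈⟦⟧⁻ : x ∈ ⟦ P? ⟧ → P x
  ∈⟦⟧⁻ x∈ with P? x | trans (sym (lookup∘tabulate (λ x → does (P? x)) x)) ([]=⇒lookup x∈)
  ... | yes px | _ = px
  ... | no _ | ()

module _ (G : Graph n) where

  Adj? : ∀ u v → Dec (Adj G u v)
  Adj? u v = adj G u v ≟ᵇ true

  Adj-sym : ∀ {u v} → Adj G u v → Adj G v u
  Adj-sym {u} {v} u~v = trans (Graph.sym G v u) u~v

  ¬Adj-refl : ∀ {v} → ¬ Adj G v v
  ¬Adj-refl {v} v~v with trans (sym v~v) (Graph.irrefl G v)
  ... | ()

  Adj⇒≢ : ∀ {u v} → Adj G u v → u ≢ v
  Adj⇒≢ u~v refl = ¬Adj-refl u~v

  ¬Adj⇒adj≡false : ∀ {u v} → ¬ Adj G u v → adj G u v ≡ false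
  ¬Adj⇒adj≡false = ¬-not

  NoIndependentTriple : Set
  NoIndependentTriple = ∀ {a b c} → a ≢ b → a ≢ c → b ≢ c → Adj G a b ⊎ Adj G a c ⊎ Adj G b c

  IndependentTriple : Fin n → Fin n → Fin n → Set
  IndependentTriple x y z = x ≢ y × x ≢ z × y ≢ z × ¬ Adj G x y × ¬ Adj G x z × ¬ Adj G y z

  independentTriple⊎α≤2 : (∃[ x ] ∃[ y ] ∃[ z ] IndependentTriple x y z) ⊎ NoIndependentTriple
  independentTriple⊎α≤2 with any? (λ x → any? (λ y → any? (λ z →
    ¬? (x ≟ y) ×-dec ¬? (x ≟ z) ×-dec ¬? (y ≟ z) ×-dec
    ¬? (Adj? x y) ×-dec ¬? (Adj? x z) ×-dec ¬? (Adj? y z))))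
  ... | yes triple = inj₁ triple
  ... | no none = inj₂ α≤2
    where
    α≤2 : NoIndependentTriple
    α≤2 {a} {b} {c} a≢b a≢c b≢c with Adj? a b | Adj? a c | Adj? b c
    ... | yes a~b | _ | _ = inj₁ a~b
    ... | no _ | yes a~c | _ = inj₂ (inj₁ a~c)
    ... | no _ | no _ | yes b~c = inj₂ (inj₂ b~c)
    ... | no a≁b | no a≁c | no b≁c = ⊥-elim (none (a , b , c , a≢b , a≢c , b≢c , a≁b , a≁c , b≁c))

  nonNeighbours-adjacent : NoIndependentTriple →
    ∀ {x u v} → u ≢ x → v ≢ x → u ≢ v → ¬ Adj G x u → ¬ Adj G x v → Adj G u v
  nonNeighbours-adjacent α≤2 u≢x v≢x u≢v x≁u x≁v with α≤2 u≢v u≢x v≢x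
  ... | inj₁ u~v = u~v
  ... | inj₂ (inj₁ u~x) = ⊥-elim (x≁u (Adj-sym u~x))
  ... | inj₂ (inj₂ v~x) = ⊥-elim (x≁v (Adj-sym v~x))

  independent-⊥ : Independent G ⊥
  independent-⊥ _ _ u∈ = ⊥-elim (∉⊥ u∈)

  independent-insert : ∀ {p x} → Independent G p → (∀ y → y ∈ p → ¬ Adj G x y) →
    Independent G (p [ x ]≔ inside)
  independent-insert indep x≁p u v u∈ v∈ with ∈-insert⁻ u∈ | ∈-insert⁻ v∈
  ... | inj₁ refl | inj₁ refl = ¬Adj-refl
  ... | inj₁ refl | inj₂ v∈p = x≁p v v∈p
  ... | inj₂ u∈p | inj₁ refl = λ u~x → x≁p u u∈p (Adj-sym u~x)
  ... | inj₂ u∈p | inj₂ v∈p = indep u v u∈p v∈p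

  independent-⟅,⟆ : ∀ {x y} → ¬ Adj G x y → Independent G ⟅ x , y ⟆
  independent-⟅,⟆ {x} {y} x≁y =
    independent-insert (independent-insert independent-⊥ (λ _ v∈ → ⊥-elim (∉⊥ v∈))) y≁
    where
    y≁ : ∀ v → v ∈ ⊥ [ x ]≔ inside → ¬ Adj G y v
    y≁ v v∈ with ∈-insert⁻ v∈
    ... | inj₁ refl = λ y~x → x≁y (Adj-sym y~x)
    ... | inj₂ v∈⊥ = ⊥-elim (∉⊥ v∈⊥)

  independent-⁅,,⁆ : ∀ {x y z} → ¬ Adj G x y → ¬ Adj G x z → ¬ Adj G y z → Independent G ⁅ x , y , z ⁆
  independent-⁅,,⁆ {x} {y} {z} x≁y x≁z y≁z = independent-insert (independent-⟅,⟆ x≁y) z≁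
    where
    z≁ : ∀ v → v ∈ ⟅ x , y ⟆ → ¬ Adj G z v
    z≁ v v∈ with ∈⟅,⟆⁻ v∈
    ... | inj₁ refl = λ z~x → x≁z (Adj-sym z~x)
    ... | inj₂ refl = λ z~y → y≁z (Adj-sym z~y)

  α≤2⇒∣independent∣≤2 : NoIndependentTriple → ∀ S → Independent G S → ∣ S ∣ ≤ 2
  α≤2⇒∣independent∣≤2 α≤2 S indep with ∣ S ∣ in ∣S∣≡
  ... | 0 = z≤n
  ... | 1 = s≤s z≤n
  ... | 2 = s≤s (s≤s z≤n)
  ... | suc (suc (suc k)) with ∣p∣≡3+k⇒ {p = S} ∣S∣≡
  ...   | a , b , c , r , a≢b , a≢c , b≢c , _ , refl =
    ⊥-elim ([ indep a b a∈ b∈ , [ indep a c a∈ c∈ , indep b c b∈ c∈ ]′ ]′ (α≤2 a≢b a≢c b≢c))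
    where
    a∈ : a ∈ S
    a∈ = ∈-insert⁺ (∈-insert⁺ (∈-insert a))
    b∈ : b ∈ S
    b∈ = ∈-insert⁺ (∈-insert b)
    c∈ : c ∈ S
    c∈ = ∈-insert c

  α≡2⇒α≤2 : IndependenceNumberIs G 2 → NoIndependentTriple
  α≡2⇒α≤2 (_ , ∣independent∣≤2) with independentTriple⊎α≤2
  ... | inj₂ α≤2 = α≤2
  ... | inj₁ (x , y , z , x≢y , x≢z , y≢z , x≁y , x≁z , y≁z)
    with subst (_≤ 2) (∣⁅,,⁆∣ x≢y x≢z y≢z) (∣independent∣≤2 _ (independent-⁅,,⁆ x≁y x≁z y≁z))
  ...   | s≤s (s≤s ())

  α≡2⇒nonAdjacentPair : IndependenceNumberIs G 2 → ∃[ x ] ∃[ y ] x ≢ y × ¬ Adj G x y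
  α≡2⇒nonAdjacentPair ((S , indep , ∣S∣≡2) , _) with ∣p∣≡2+k⇒ {p = S} ∣S∣≡2
  ... | a , b , r , a≢b , _ , refl = a , b , a≢b , indep a b (∈-insert⁺ (∈-insert a)) (∈-insert b)

  nonAdjacentPair⇒α≡2 : ∀ {x y} → x ≢ y → ¬ Adj G x y → NoIndependentTriple → IndependenceNumberIs G 2
  nonAdjacentPair⇒α≡2 x≢y x≁y α≤2 =
    (⟅ _ , _ ⟆ , independent-⟅,⟆ x≁y , ∣⟅,⟆∣ x≢y) , α≤2⇒∣independent∣≤2 α≤2

-- Jumps and reachability

jump : Subset n → Fin n → Fin n → Fin n → Subset n
jump D u v w = D [ u ]≔ outside [ v ]≔ outside [ w ]≔ inside

module _ {D : Subset n} {u v w : Fin n} where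

  ∈-jump-target : w ∈ jump D u v w
  ∈-jump-target = ∈-insert w

  ∈-jump⁺ : ∀ {x} → x ∈ D → x ≢ u → x ≢ v → x ∈ jump D u v w
  ∈-jump⁺ x∈ x≢u x≢v = ∈-insert⁺ (∈-update⁺ x≢v (∈-update⁺ x≢u x∈))

  ∈-jump⁻ : ∀ {x} → x ∈ jump D u v w → x ≡ w ⊎ (x ∈ D × x ≢ u × x ≢ v)
  ∈-jump⁻ x∈ with ∈-insert⁻ x∈
  ... | inj₁ x≡w = inj₁ x≡w
  ... | inj₂ x∈′ with ∈-remove⁻ x∈′
  ...   | x≢v , x∈″ with ∈-remove⁻ x∈″
  ...     | x≢u , x∈D = inj₂ (x∈D , x≢u , x≢v)

  ∉-jump : ∀ {x} → x ∉ D → x ≢ w → x ∉ jump D u v w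
  ∉-jump x∉ x≢w x∈ with ∈-jump⁻ x∈
  ... | inj₁ x≡w = x≢w x≡w
  ... | inj₂ (x∈D , _) = x∉ x∈D

module _ (G : Graph n) where

  jump-move : ∀ {D u v w} → u ≢ v → u ∈ D → v ∈ D → Adj G u v → w ∉ D → Adj G v w →
    PegMove G D (jump D u v w)
  jump-move u≢v u∈ v∈ u~v w∉ v~w = _ , _ , _ , u≢v , u∈ , v∈ , u~v , w∉ , v~w , refl

  PegMove⇒∣∣ : ∀ {D D′} → PegMove G D D′ → ∣ D ∣ ≡ suc ∣ D′ ∣
  PegMove⇒∣∣ {D} (u , v , w , u≢v , u∈ , v∈ , _ , w∉ , _ , refl) = begin
    ∣ D ∣                                   ≡⟨ ∣remove∣ D u∈ ⟩
    suc ∣ D [ u ]≔ outside ∣                ≡⟨ cong suc (∣remove∣ _ (∈-update⁺ (≢-sym u≢v) v∈)) ⟩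
    2 + ∣ D [ u ]≔ outside [ v ]≔ outside ∣ ≡⟨ cong suc (sym (∣insert∣ _ w∉′)) ⟩
    suc ∣ jump D u v w ∣                    ∎
    where
    open ≡-Reasoning
    w∉′ : w ∉ D [ u ]≔ outside [ v ]≔ outside
    w∉′ w∈ = w∉ (proj₂ (∈-remove⁻ (proj₂ (∈-remove⁻ w∈))))

  ∣∣≡1⇒¬PegMove : ∀ {D D′} → ∣ D ∣ ≡ 1 → ¬ PegMove G D D′
  ∣∣≡1⇒¬PegMove {D} ∣D∣≡1 m@(u , v , w , _ , _ , _ , _ , _ , _ , refl) =
    ∣p∣≡0⇒x∉p (suc-injective (trans (sym (PegMove⇒∣∣ m)) ∣D∣≡1)) (∈-jump-target {D = D} {u} {v} {w})

  independent⇒¬PegMove : ∀ {D D′} → Independent G D → ¬ PegMove G D D′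
  independent⇒¬PegMove indep (u , v , _ , _ , u∈ , v∈ , u~v , _) = indep u v u∈ v∈ u~v

  reach-here : ∀ {D t} → t ∈ D → Reachable G D t
  reach-here t∈ = _ , ε , t∈

  reach-after : ∀ {D D′ t} → PegMove G D D′ → Reachable G D′ t → Reachable G D t
  reach-after m (E , ms , t∈) = E , m ◅ ms , t∈

  reach-by-jump : ∀ {D u v t} → u ≢ v → u ∈ D → v ∈ D → Adj G u v → t ∉ D → Adj G v t →
    Reachable G D t
  reach-by-jump u≢v u∈ v∈ u~v t∉ v~t =
    reach-after (jump-move u≢v u∈ v∈ u~v t∉ v~t) (reach-here ∈-jump-target)

  stuck⇒Reach⊆ : ∀ {D t} → (∀ {D′} → ¬ PegMove G D D′) → Reachable G D t → t ∈ D
  stuck⇒Reach⊆ stuck (_ , ε , t∈) = t∈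
  stuck⇒Reach⊆ stuck (_ , m ◅ _ , _) = ⊥-elim (stuck m)

  stuck⇒¬AllReach : ∀ {D t} → (∀ {D′} → ¬ PegMove G D D′) → t ∉ D → ¬ AllReach G ∣ D ∣
  stuck⇒¬AllReach {D} {t} stuck t∉ allReach = t∉ (stuck⇒Reach⊆ stuck (allReach D refl t))

  independent⇒¬AllReach : ∀ {D t} → Independent G D → t ∉ D → ¬ AllReach G ∣ D ∣
  independent⇒¬AllReach indep = stuck⇒¬AllReach (independent⇒¬PegMove indep)

  AllReach-all : AllReach G n
  AllReach-all D ∣D∣≡n t = reach-here (subst (t ∈_) (sym (∣p∣≡n⇒p≡⊤ ∣D∣≡n)) ∈⊤)

  complete⇒AllReach : (∀ {u v} → u ≢ v → Adj G u v) → AllReach G (2 + k)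
  complete⇒AllReach complete D ∣D∣≡2+k t with t ∈? D | ∣p∣≡2+k⇒ {p = D} ∣D∣≡2+k
  ... | yes t∈ | _ = reach-here t∈
  ... | no t∉ | a , b , r , a≢b , _ , refl =
    reach-by-jump a≢b (∈-insert⁺ (∈-insert a)) (∈-insert b) (complete a≢b) t∉
      (complete (λ { refl → t∉ (∈-insert b) }))

  ¬AllReach2⇒nonAdjacentPair : ¬ AllReach G 2 → ∃[ x ] ∃[ y ] x ≢ y × ¬ Adj G x y
  ¬AllReach2⇒nonAdjacentPair ¬allReach2 with any? (λ x → any? (λ y → ¬? (x ≟ y) ×-dec ¬? (Adj? G x y)))
  ... | yes pair = pair
  ... | no none = ⊥-elim (¬allReach2 (complete⇒AllReach complete))
    where
    complete : ∀ {u v} → u ≢ v → Adj G u v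
    complete {u} {v} u≢v with Adj? G u v
    ... | yes u~v = u~v
    ... | no u≁v = ⊥-elim (none (u , v , u≢v , u≁v))

  twoVertices⇒¬AllReach1 : ∀ {x y : Fin n} → x ≢ y → ¬ AllReach G 1
  twoVertices⇒¬AllReach1 {x} {y} x≢y =
    subst (λ d → ¬ AllReach G d) (∣⁅x⁆∣≡1 x) (independent⇒¬AllReach singleton y∉)
    where
    singleton : Independent G Subset.⁅ x ⁆
    singleton u v u∈ v∈ rewrite x∈⁅y⁆⇒x≡y x u∈ | x∈⁅y⁆⇒x≡y x v∈ = ¬Adj-refl G
    y∉ : y ∉ Subset.⁅ x ⁆
    y∉ y∈ = x≢y (sym (x∈⁅y⁆⇒x≡y x y∈))

  nonAdjacentPair⇒¬AllReach2 : ∀ {x y z} → x ≢ y → ¬ Adj G x y → z ∉ ⟅ x , y ⟆ → ¬ AllReach G 2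
  nonAdjacentPair⇒¬AllReach2 x≢y x≁y z∉ =
    subst (λ d → ¬ AllReach G d) (∣⟅,⟆∣ x≢y) (independent⇒¬AllReach (independent-⟅,⟆ G x≁y) z∉)

-- The first jump takes x over y onto the empty vertex w; then w is jumped over, or jumps, onto t.
module _ (G : Graph n) {D : Subset n} {x y z w t : Fin n}
         (x≢y : x ≢ y) (x∈ : x ∈ D) (y∈ : y ∈ D) (x~y : Adj G x y) (w∉ : w ∉ D) (y~w : Adj G y w)
         (z∈ : z ∈ D) (z≢x : z ≢ x) (z≢y : z ≢ y) (t∉ : t ∉ D) where

  reach-over-landing : Adj G z w → Adj G w t → Reachable G D t
  reach-over-landing z~w w~t =
    reach-after G (jump-move G x≢y x∈ y∈ x~y w∉ y~w)
      (reach-by-jump G (Adj⇒≢ G z~w) (∈-jump⁺ z∈ z≢x z≢y) ∈-jump-target z~w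
        (∉-jump t∉ (≢-sym (Adj⇒≢ G w~t))) w~t)

  reach-from-landing : Adj G w z → Adj G z t → t ≢ w → Reachable G D t
  reach-from-landing w~z z~t t≢w =
    reach-after G (jump-move G x≢y x∈ y∈ x~y w∉ y~w)
      (reach-by-jump G (Adj⇒≢ G w~z) ∈-jump-target (∈-jump⁺ z∈ z≢x z≢y) w~z (∉-jump t∉ t≢w) z~t)

-- Isomorphisms and 2K₂

module _ (G : Graph n) (H : Graph m) (G≅H : G ≅ H) where
  open Inverse (proj₁ G≅H)

  ≅⇒≡ : n ≡ m
  ≅⇒≡ = ↔⇒≡ (proj₁ G≅H)

  Adj-≅ : ∀ {u v} → Adj G u v → Adj H (to u) (to v)
  Adj-≅ {u} {v} u~v = trans (sym (proj₂ G≅H u v)) u~v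

  to-injective : ∀ {u v} → to u ≡ to v → u ≡ v
  to-injective {u} {v} e = trans (sym (strictlyInverseʳ u)) (trans (cong from e) (strictlyInverseʳ v))

  from-injective : ∀ {i j} → from i ≡ from j → i ≡ j
  from-injective {i} {j} e = trans (sym (strictlyInverseˡ i)) (trans (cong to e) (strictlyInverseˡ j))

≅-byEnumeration : ∀ {n m} (G : Graph n) (H : Graph m) (f : Fin m → Fin n) →
  (∀ {i j} → f i ≡ f j → i ≡ j) → (∀ v → ∃[ i ] f i ≡ v) →
  (∀ i j → adj G (f i) (f j) ≡ adj H i j) → G ≅ H
≅-byEnumeration {n} {m} G H f f-injective enum f-adj =
  mk↔ₛ′ index f (λ i → f-injective (proj₂ (enum (f i)))) (λ v → proj₂ (enum v)) , index-adj
  where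
  index : Fin n → Fin m
  index v = proj₁ (enum v)
  index-adj : ∀ u v → adj G u v ≡ adj H (index u) (index v)
  index-adj u v =
    trans (cong₂ (adj G) (sym (proj₂ (enum u))) (sym (proj₂ (enum v)))) (f-adj (index u) (index v))

module _ (G : Graph n) where

  edgeless⇒≅emptyGraph : (∀ {u v} → ¬ Adj G u v) → G ≅ emptyGraph n
  edgeless⇒≅emptyGraph edgeless =
    mk↔ₛ′ id id (λ _ → refl) (λ _ → refl) , λ _ _ → ¬Adj⇒adj≡false G edgeless

  ≅emptyGraph⇒¬Adj : G ≅ emptyGraph k → ∀ {u v} → ¬ Adj G u v
  ≅emptyGraph⇒¬Adj G≅kK₁ {u} {v} u~v with trans (sym u~v) (proj₂ G≅kK₁ u v)
  ... | ()

  covering-independent⇒≅emptyGraph : ∀ {p} → (∀ v → v ∈ p) → Independent G p → G ≅ emptyGraph ∣ p ∣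
  covering-independent⇒≅emptyGraph {p} cover indep =
    subst (λ k → G ≅ emptyGraph k) n≡∣p∣ (edgeless⇒≅emptyGraph (indep _ _ (cover _) (cover _)))
    where
    n≡∣p∣ : n ≡ ∣ p ∣
    n≡∣p∣ = trans (sym (∣⊤∣≡n n)) (cong ∣_∣ (⊆-antisym (λ _ → cover _) ⊆⊤))

MaxDegree≤1 : Graph n → Set
MaxDegree≤1 G = ∀ {v u w} → Adj G v u → Adj G v w → u ≡ w

maxDegree≤1⇒¬PegMove : ∀ (G : Graph n) {D D′} → MaxDegree≤1 G → ¬ PegMove G D D′
maxDegree≤1⇒¬PegMove G deg≤1 (u , v , w , _ , u∈ , _ , u~v , w∉ , v~w , _) =
  w∉ (subst (_∈ _) (deg≤1 (Adj-sym G u~v) v~w) u∈)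

≅-maxDegree≤1 : ∀ (G : Graph n) (H : Graph m) → G ≅ H → MaxDegree≤1 H → MaxDegree≤1 G
≅-maxDegree≤1 G H G≅H deg≤1 v~u v~w = to-injective G H G≅H (deg≤1 (Adj-≅ G H G≅H v~u) (Adj-≅ G H G≅H v~w))

-- If f i ≡ f j, the neighbour of i in H is also adjacent to j, and it has only one neighbour.
enumeration-injective : ∀ {n m} (G : Graph n) (H : Graph m) (f : Fin m → Fin n) →
  (∀ i j → adj G (f i) (f j) ≡ adj H i j) → MaxDegree≤1 H → (∀ i → ∃[ j ] Adj H i j) →
  ∀ {i j} → f i ≡ f j → i ≡ j
enumeration-injective {m = m} G H f f-adj deg≤1 neighbour {i} {j} fi≡fj =
  deg≤1 (Adj-sym H (proj₂ (neighbour i))) (Adj-sym H j~p)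
  where
  open ≡-Reasoning
  p : Fin m
  p = proj₁ (neighbour i)
  j~p : Adj H j p
  j~p = begin
    adj H j p         ≡⟨ sym (f-adj j p) ⟩
    adj G (f j) (f p) ≡⟨ cong (λ v → adj G v (f p)) (sym fi≡fj) ⟩
    adj G (f i) (f p) ≡⟨ f-adj i p ⟩
    adj H i p         ≡⟨ proj₂ (neighbour i) ⟩
    true              ∎

pattern 0F = zero
pattern 1F = suc zero
pattern 2F = suc (suc zero)
pattern 3F = suc (suc (suc zero))

2K₂-maxDegree≤1 : MaxDegree≤1 2K₂
2K₂-maxDegree≤1 {0F} {1F} {1F} _ _ = refl
2K₂-maxDegree≤1 {1F} {0F} {0F} _ _ = refl
2K₂-maxDegree≤1 {2F} {3F} {3F} _ _ = refl
2K₂-maxDegree≤1 {3F} {2F} {2F} _ _ = refl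

2K₂-neighbour : ∀ i → ∃[ j ] Adj 2K₂ i j
2K₂-neighbour 0F = 1F , refl
2K₂-neighbour 1F = 0F , refl
2K₂-neighbour 2F = 3F , refl
2K₂-neighbour 3F = 2F , refl

≅2K₂⇒¬AllReach3 : ∀ {n} (G : Graph n) → G ≅ 2K₂ → ¬ AllReach G 3
≅2K₂⇒¬AllReach3 {n} G G≅2K₂ =
  subst (λ d → ¬ AllReach G d) (∣⁅,,⁆∣ (f≢ λ ()) (f≢ λ ()) (f≢ λ ()))
    (stuck⇒¬AllReach G (maxDegree≤1⇒¬PegMove G (≅-maxDegree≤1 G 2K₂ G≅2K₂ 2K₂-maxDegree≤1)) f3∉)
  where
  f : Fin 4 → Fin n
  f = Inverse.from (proj₁ G≅2K₂)
  f≢ : ∀ {i j} → i ≢ j → f i ≢ f j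
  f≢ i≢j e = i≢j (from-injective G 2K₂ G≅2K₂ e)
  f3∉ : f 3F ∉ ⁅ f 0F , f 1F , f 2F ⁆
  f3∉ = ∉⁅,,⁆ (f≢ λ ()) (f≢ λ ()) (f≢ λ ())

module _ (G : Graph n) {a b c t : Fin n} where

  twoEdges⇒≅2K₂ : (∀ v → v ≡ a ⊎ v ≡ b ⊎ v ≡ c ⊎ v ≡ t) → Adj G a b → Adj G c t →
    ¬ Adj G a c → ¬ Adj G a t → ¬ Adj G b c → ¬ Adj G b t → G ≅ 2K₂
  twoEdges⇒≅2K₂ cover a~b c~t a≁c a≁t b≁c b≁t =
    ≅-byEnumeration G 2K₂ f (enumeration-injective G 2K₂ f f-adj 2K₂-maxDegree≤1 2K₂-neighbour) enum f-adj
    where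
    f : Fin 4 → Fin n
    f 0F = a
    f 1F = b
    f 2F = c
    f 3F = t
    enum : ∀ v → ∃[ i ] f i ≡ v
    enum v with cover v
    ... | inj₁ refl = 0F , refl
    ... | inj₂ (inj₁ refl) = 1F , refl
    ... | inj₂ (inj₂ (inj₁ refl)) = 2F , refl
    ... | inj₂ (inj₂ (inj₂ refl)) = 3F , refl
    ≁⇒false : ∀ {u v} → ¬ Adj G u v → adj G v u ≡ false
    ≁⇒false u≁v = ¬Adj⇒adj≡false G (u≁v ∘ Adj-sym G)
    f-adj : ∀ i j → adj G (f i) (f j) ≡ 2K₂-adj i j
    f-adj 0F 0F = Graph.irrefl G a
    f-adj 0F 1F = a~b
    f-adj 0F 2F = ¬Adj⇒adj≡false G a≁c
    f-adj 0F 3F = ¬Adj⇒adj≡false G a≁t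
    f-adj 1F 0F = Adj-sym G a~b
    f-adj 1F 1F = Graph.irrefl G b
    f-adj 1F 2F = ¬Adj⇒adj≡false G b≁c
    f-adj 1F 3F = ¬Adj⇒adj≡false G b≁t
    f-adj 2F 0F = ≁⇒false a≁c
    f-adj 2F 1F = ≁⇒false b≁c
    f-adj 2F 2F = Graph.irrefl G c
    f-adj 2F 3F = c~t
    f-adj 3F 0F = ≁⇒false a≁t
    f-adj 3F 1F = ≁⇒false b≁t
    f-adj 3F 2F = Adj-sym G c~t
    f-adj 3F 3F = Graph.irrefl G t

-- Three pegs when α(G) ≤ 2

module Neighbourhood (G : Graph n) where

  N[_] : Fin n → Subset n
  N[ x ] = ⟦ (λ v → (v ≟ x) ⊎-dec Adj? G x v) ⟧

  module _ {x v : Fin n} where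

    ∈N[]⁺ : v ≡ x ⊎ Adj G x v → v ∈ N[ x ]
    ∈N[]⁺ = ∈⟦⟧⁺ (λ v → (v ≟ x) ⊎-dec Adj? G x v)

    ∈N[]⁻ : v ∈ N[ x ] → v ≡ x ⊎ Adj G x v
    ∈N[]⁻ = ∈⟦⟧⁻ (λ v → (v ≟ x) ⊎-dec Adj? G x v)

    ∈∁N[]⁺ : v ≢ x → ¬ Adj G x v → v ∈ ∁ N[ x ]
    ∈∁N[]⁺ v≢x x≁v = x∉p⇒x∈∁p λ v∈ → [ v≢x , x≁v ]′ (∈N[]⁻ v∈)

    ∈∁N[]⁻ : v ∈ ∁ N[ x ] → v ≢ x × ¬ Adj G x v
    ∈∁N[]⁻ v∈ = x∈∁p⇒x∉p v∈ ∘ ∈N[]⁺ ∘ inj₁ , x∈∁p⇒x∉p v∈ ∘ ∈N[]⁺ ∘ inj₂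

  N[]∪∁N[] : ∀ x → N[ x ] ∪ ∁ N[ x ] ≡ ⊤
  N[]∪∁N[] x = p∪∁p≡⊤ N[ x ]

  ∁N[]∪N[] : ∀ x → ∁ N[ x ] ∪ N[ x ] ≡ ⊤
  ∁N[]∪N[] x = trans (∪-comm (∁ N[ x ]) N[ x ]) (p∪∁p≡⊤ N[ x ])

  module _ (α≤2 : NoIndependentTriple G) {x : Fin n} where

    ∁N[]-clique : Clique G (∁ N[ x ])
    ∁N[]-clique u v u∈ v∈ u≢v with ∈∁N[]⁻ u∈ | ∈∁N[]⁻ v∈
    ... | u≢x , x≁u | v≢x , x≁v = nonNeighbours-adjacent G α≤2 u≢x v≢x u≢v x≁u x≁v

    N[]-clique :
      (∀ {p q} → Adj G x p → Adj G x q → ∃[ z ] ¬ Adj G x z × ¬ Adj G z p × ¬ Adj G z q) →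
      Clique G N[ x ]
    N[]-clique separated u v u∈ v∈ u≢v with ∈N[]⁻ u∈ | ∈N[]⁻ v∈
    ... | inj₁ refl | inj₁ refl = ⊥-elim (u≢v refl)
    ... | inj₁ refl | inj₂ x~v = x~v
    ... | inj₂ x~u | inj₁ refl = Adj-sym G x~u
    ... | inj₂ x~u | inj₂ x~v with separated x~u x~v
    ...   | z , x≁z , z≁u , z≁v =
      nonNeighbours-adjacent G α≤2 (λ { refl → x≁z x~u }) (λ { refl → x≁z x~v }) u≢v z≁u z≁v

module _ (G : Graph n) where

  AdjacentToTwo : Fin n → Fin n → Fin n → Fin n → Set
  AdjacentToTwo w a b c = (Adj G w a × Adj G w b) ⊎ (Adj G w a × Adj G w c) ⊎ (Adj G w b × Adj G w c)

  adjacentToTwo? : ∀ w a b c → Dec (AdjacentToTwo w a b c)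
  adjacentToTwo? w a b c =
    (Adj? G w a ×-dec Adj? G w b) ⊎-dec (Adj? G w a ×-dec Adj? G w c) ⊎-dec (Adj? G w b ×-dec Adj? G w c)

  module _ {w a b c : Fin n} where

    ¬adjacentToTwo⇒atMostOne : ¬ AdjacentToTwo w a b c → AtMostOneAdj G w a b c
    ¬adjacentToTwo⇒atMostOne two = two ∘ inj₁ , two ∘ inj₂ ∘ inj₁ , two ∘ inj₂ ∘ inj₂

    ¬Adj⇒atMostOne : ¬ Adj G w a → ¬ Adj G w b → AtMostOneAdj G w a b c
    ¬Adj⇒atMostOne w≁a w≁b = w≁a ∘ proj₁ , w≁a ∘ proj₁ , w≁b ∘ proj₁

  commonNonNeighbour : ∀ {p q a b c} → AtMostOneAdj G p a b c → AtMostOneAdj G q a b c →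
    ∃[ z ] (z ≡ a ⊎ z ≡ b ⊎ z ≡ c) × ¬ Adj G p z × ¬ Adj G q z
  commonNonNeighbour {p} {q} {a} {b} (p≁ab , p≁ac , p≁bc) (q≁ab , q≁ac , q≁bc)
    with Adj? G p a | Adj? G q a
  ... | no p≁a | no q≁a = a , inj₁ refl , p≁a , q≁a
  ... | yes p~a | _ with Adj? G q b
  ...   | yes q~b = _ , inj₂ (inj₂ refl) , (λ p~c → p≁ac (p~a , p~c)) , (λ q~c → q≁bc (q~b , q~c))
  ...   | no q≁b = b , inj₂ (inj₁ refl) , (λ p~b → p≁ab (p~a , p~b)) , q≁b
  commonNonNeighbour {p} {q} {a} {b} (p≁ab , p≁ac , p≁bc) (q≁ab , q≁ac , q≁bc)
    | no p≁a | yes q~a with Adj? G p b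
  ...   | yes p~b = _ , inj₂ (inj₂ refl) , (λ p~c → p≁bc (p~b , p~c)) , (λ q~c → q≁ac (q~a , q~c))
  ...   | no p≁b = b , inj₂ (inj₁ refl) , p≁b , (λ q~b → q≁ab (q~a , q~b))

module _ (G : Graph n) (α≤2 : NoIndependentTriple G) {a b c t : Fin n}
         (a≢b : a ≢ b) (a≢c : a ≢ c) (b≢c : b ≢ c) (a~b : Adj G a b)
         (t∉ : t ∉ ⁅ a , b , c ⁆) (t≁a : ¬ Adj G t a) (t≁b : ¬ Adj G t b) where

  open Neighbourhood G

  private
    a∈ : a ∈ ⁅ a , b , c ⁆
    a∈ = a∈⁅,,⁆
    b∈ : b ∈ ⁅ a , b , c ⁆
    b∈ = b∈⁅,,⁆
    c∈ : c ∈ ⁅ a , b , c ⁆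
    c∈ = c∈⁅,,⁆
    ≢t : ∀ {v} → v ∈ ⁅ a , b , c ⁆ → v ≢ t
    ≢t v∈ refl = t∉ v∈

  module _ (a~c : Adj G a c) (b~c : Adj G b c) (t≁c : ¬ Adj G t c) where

    private
      ∉-of-t-neighbour : ∀ {w} → Adj G t w → w ∉ ⁅ a , b , c ⁆
      ∉-of-t-neighbour t~w = ∉⁅,,⁆ (λ { refl → t≁a t~w }) (λ { refl → t≁b t~w }) (λ { refl → t≁c t~w })

    triangle-relay : ∀ {w} → Adj G t w → AdjacentToTwo G w a b c → Reachable G ⁅ a , b , c ⁆ t
    triangle-relay t~w (inj₁ (w~a , w~b)) =
      reach-over-landing G (≢-sym a≢c) c∈ a∈ (Adj-sym G a~c) (∉-of-t-neighbour t~w) (Adj-sym G w~a)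
        b∈ b≢c (≢-sym a≢b) t∉ (Adj-sym G w~b) (Adj-sym G t~w)
    triangle-relay t~w (inj₂ (inj₁ (w~a , w~c))) =
      reach-over-landing G (≢-sym a≢b) b∈ a∈ (Adj-sym G a~b) (∉-of-t-neighbour t~w) (Adj-sym G w~a)
        c∈ (≢-sym b≢c) (≢-sym a≢c) t∉ (Adj-sym G w~c) (Adj-sym G t~w)
    triangle-relay t~w (inj₂ (inj₂ (w~b , w~c))) =
      reach-over-landing G a≢b a∈ b∈ a~b (∉-of-t-neighbour t~w) (Adj-sym G w~b)
        c∈ (≢-sym a≢c) (≢-sym b≢c) t∉ (Adj-sym G w~c) (Adj-sym G t~w)

    triangle-star : (∀ {w} → Adj G t w → AtMostOneAdj G w a b c) → ConditionStar G
    triangle-star atMostOne′ =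
      N[ t ] , ∁ N[ t ] , N[]-clique α≤2 separated , ∁N[]-clique α≤2 , N[]∪∁N[] t ,
      inj₂ (inj₂ (t , a , b , c , ∈N[]⁺ (inj₁ refl) ,
        ∈∁N[]⁺ (≢t a∈) t≁a , ∈∁N[]⁺ (≢t b∈) t≁b , ∈∁N[]⁺ (≢t c∈) t≁c , a≢b , a≢c , b≢c ,
        (λ _ v∈ → proj₂ (∈∁N[]⁻ v∈)) , atMostOne))
      where
      atMostOne : ∀ w → w ∈ N[ t ] → AtMostOneAdj G w a b c
      atMostOne w w∈ with ∈N[]⁻ w∈
      ... | inj₁ refl = ¬Adj⇒atMostOne G t≁a t≁b
      ... | inj₂ t~w = atMostOne′ t~w
      separated : ∀ {p q} → Adj G t p → Adj G t q → ∃[ z ] ¬ Adj G t z × ¬ Adj G z p × ¬ Adj G z q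
      separated t~p t~q with commonNonNeighbour G (atMostOne′ t~p) (atMostOne′ t~q)
      ... | z , z∈abc , p≁z , q≁z = z , t≁z z∈abc , p≁z ∘ Adj-sym G , q≁z ∘ Adj-sym G
        where
        t≁z : ∀ {z} → z ≡ a ⊎ z ≡ b ⊎ z ≡ c → ¬ Adj G t z
        t≁z (inj₁ refl) = t≁a
        t≁z (inj₂ (inj₁ refl)) = t≁b
        t≁z (inj₂ (inj₂ refl)) = t≁c

    triangle-case : Reachable G ⁅ a , b , c ⁆ t ⊎ ConditionStar G
    triangle-case with any? (λ w → Adj? G t w ×-dec adjacentToTwo? G w a b c)
    ... | yes (w , t~w , two) = inj₁ (triangle-relay t~w two)
    ... | no none = inj₂ (triangle-star λ t~w → ¬adjacentToTwo⇒atMostOne G λ two → none (_ , t~w , two))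

  module _ (a≁c : ¬ Adj G a c) (b≁c : ¬ Adj G b c) (c~t : Adj G c t) where

    private
      ∉-of-c-neighbour : ∀ {w} → Adj G c w → w ∉ ⁅ a , b , c ⁆
      ∉-of-c-neighbour c~w =
        ∉⁅,,⁆ (λ { refl → a≁c (Adj-sym G c~w) }) (λ { refl → b≁c (Adj-sym G c~w) }) (≢-sym (Adj⇒≢ G c~w))

    pendant-relay : ∀ {w} → Adj G c w → Adj G a w ⊎ Adj G b w → Reachable G ⁅ a , b , c ⁆ t
    pendant-relay c~w (inj₁ a~w) =
      reach-from-landing G (≢-sym a≢b) b∈ a∈ (Adj-sym G a~b) (∉-of-c-neighbour c~w) a~w
        c∈ (≢-sym b≢c) (≢-sym a≢c) t∉ (Adj-sym G c~w) c~t (λ { refl → t≁a (Adj-sym G a~w) })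
    pendant-relay c~w (inj₂ b~w) =
      reach-from-landing G a≢b a∈ b∈ a~b (∉-of-c-neighbour c~w) b~w
        c∈ (≢-sym a≢c) (≢-sym b≢c) t∉ (Adj-sym G c~w) c~t (λ { refl → t≁b (Adj-sym G b~w) })

    module _ (ab≁N[c] : ∀ {v} → v ∈ N[ c ] → ¬ Adj G a v × ¬ Adj G b v) where

      private
        c≁a : ¬ Adj G c a
        c≁a = a≁c ∘ Adj-sym G
        a∈∁N[c] : a ∈ ∁ N[ c ]
        a∈∁N[c] = ∈∁N[]⁺ a≢c c≁a
        c∈N[c] : c ∈ N[ c ]
        c∈N[c] = ∈N[]⁺ (inj₁ refl)
        t∈N[c] : t ∈ N[ c ]
        t∈N[c] = ∈N[]⁺ (inj₂ c~t)
        ≁N[c] : ∀ {u v} → u ≡ a ⊎ u ≡ b → v ∈ N[ c ] → ¬ Adj G u v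
        ≁N[c] (inj₁ refl) v∈ = proj₁ (ab≁N[c] v∈)
        ≁N[c] (inj₂ refl) v∈ = proj₂ (ab≁N[c] v∈)
        N[c]-clique : Clique G N[ c ]
        N[c]-clique = N[]-clique α≤2 λ c~p c~q → a , c≁a , ≁N[c] (inj₁ refl) (∈N[]⁺ (inj₂ c~p)) ,
                                                          ≁N[c] (inj₁ refl) (∈N[]⁺ (inj₂ c~q))

      pendant-star₁ : ∀ {x} → x ∈ ∁ N[ c ] → x ≢ a → x ≢ b → ConditionStar G
      pendant-star₁ {x} x∈ x≢a x≢b =
        N[ c ] , ∁ N[ c ] , N[c]-clique , ∁N[]-clique α≤2 , N[]∪∁N[] c ,
        inj₂ (inj₂ (c , a , b , x , c∈N[c] , a∈∁N[c] , ∈∁N[]⁺ b≢c (b≁c ∘ Adj-sym G) , x∈ ,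
          a≢b , ≢-sym x≢a , ≢-sym x≢b , (λ _ v∈ → proj₂ (∈∁N[]⁻ v∈)) ,
          λ w w∈ → ¬Adj⇒atMostOne G (≁N[c] (inj₁ refl) w∈ ∘ Adj-sym G) (≁N[c] (inj₂ refl) w∈ ∘ Adj-sym G)))

      pendant-star₂ : (∀ {x} → x ∈ ∁ N[ c ] → x ≡ a ⊎ x ≡ b) →
        ∀ {y} → y ∈ N[ c ] → y ≢ c → y ≢ t → ConditionStar G
      pendant-star₂ ∁N[c]⊆ab {y} y∈ y≢c y≢t =
        ∁ N[ c ] , N[ c ] , ∁N[]-clique α≤2 , N[c]-clique , ∁N[]∪N[] c ,
        inj₂ (inj₂ (a , c , t , y , a∈∁N[c] , c∈N[c] , t∈N[c] , y∈ ,
          Adj⇒≢ G c~t , ≢-sym y≢c , ≢-sym y≢t , (λ _ v∈ → ≁N[c] (inj₁ refl) v∈) ,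
          λ u u∈ → ¬Adj⇒atMostOne G (≁N[c] (∁N[c]⊆ab u∈) c∈N[c]) (≁N[c] (∁N[c]⊆ab u∈) t∈N[c])))

      pendant-star₃ : (∀ {x} → x ∈ ∁ N[ c ] → x ≡ a ⊎ x ≡ b) → (∀ {y} → y ∈ N[ c ] → y ≡ c ⊎ y ≡ t) →
        ConditionStar G
      pendant-star₃ ∁N[c]⊆ab N[c]⊆ct =
        ∁ N[ c ] , N[ c ] , ∁N[]-clique α≤2 , N[c]-clique , ∁N[]∪N[] c ,
        inj₂ (inj₁ (twoEdges⇒≅2K₂ G cover a~b c~t a≁c (≁N[c] (inj₁ refl) t∈N[c]) b≁c (≁N[c] (inj₂ refl) t∈N[c])))
        where
        cover : ∀ v → v ≡ a ⊎ v ≡ b ⊎ v ≡ c ⊎ v ≡ t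
        cover v with v ∈? N[ c ]
        ... | yes v∈ = inj₂ (inj₂ (N[c]⊆ct v∈))
        ... | no v∉ with ∁N[c]⊆ab (x∉p⇒x∈∁p v∉)
        ...   | inj₁ v≡a = inj₁ v≡a
        ...   | inj₂ v≡b = inj₂ (inj₁ v≡b)

      pendant-star : ConditionStar G
      pendant-star with any? (λ x → (x ∈? ∁ N[ c ]) ×-dec ¬? (x ≟ a) ×-dec ¬? (x ≟ b))
      ... | yes (x , x∈ , x≢a , x≢b) = pendant-star₁ x∈ x≢a x≢b
      ... | no ∁N[c]-small with any? (λ y → (y ∈? N[ c ]) ×-dec ¬? (y ≟ c) ×-dec ¬? (y ≟ t))
      ...   | yes (y , y∈ , y≢c , y≢t) = pendant-star₂ (¬∃≢⇒≡⊎≡ ∁N[c]-small) y∈ y≢c y≢t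
      ...   | no N[c]-small = pendant-star₃ (¬∃≢⇒≡⊎≡ ∁N[c]-small) (¬∃≢⇒≡⊎≡ N[c]-small)

    pendant-case : Reachable G ⁅ a , b , c ⁆ t ⊎ ConditionStar G
    pendant-case with any? (λ w → Adj? G c w ×-dec (Adj? G a w ⊎-dec Adj? G b w))
    ... | yes (w , c~w , a∨b~w) = inj₁ (pendant-relay c~w a∨b~w)
    ... | no none = inj₂ (pendant-star ab≁N[c])
      where
      ab≁N[c] : ∀ {v} → v ∈ N[ c ] → ¬ Adj G a v × ¬ Adj G b v
      ab≁N[c] v∈ with ∈N[]⁻ v∈
      ... | inj₁ refl = a≁c , b≁c
      ... | inj₂ c~v = (λ a~v → none (_ , c~v , inj₁ a~v)) , (λ b~v → none (_ , c~v , inj₂ b~v))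

module _ (G : Graph n) (α≤2 : NoIndependentTriple G) where

  reach-from-edge : ∀ {a b c} → a ≢ b → a ≢ c → b ≢ c → Adj G a b → ∀ t →
    Reachable G ⁅ a , b , c ⁆ t ⊎ ConditionStar G
  reach-from-edge {a} {b} {c} a≢b a≢c b≢c a~b t with t ∈? ⁅ a , b , c ⁆
  ... | yes t∈ = inj₁ (reach-here G t∈)
  ... | no t∉ with Adj? G t b | Adj? G t a
  ...   | yes t~b | _ = inj₁ (reach-by-jump G a≢b a∈⁅,,⁆ b∈⁅,,⁆ a~b t∉ (Adj-sym G t~b))
  ...   | no _ | yes t~a = inj₁ (reach-by-jump G (≢-sym a≢b) b∈⁅,,⁆ a∈⁅,,⁆ (Adj-sym G a~b) t∉ (Adj-sym G t~a))
  ...   | no t≁b | no t≁a with Adj? G c t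
  ...     | no c≁t = triangle-case G α≤2 a≢b a≢c b≢c a~b t∉ t≁a t≁b
    (nonNeighbours-adjacent G α≤2 (≢t a∈⁅,,⁆) (≢t c∈⁅,,⁆) a≢c t≁a t≁c)
    (nonNeighbours-adjacent G α≤2 (≢t b∈⁅,,⁆) (≢t c∈⁅,,⁆) b≢c t≁b t≁c) t≁c
    where
    t≁c : ¬ Adj G t c
    t≁c = c≁t ∘ Adj-sym G
    ≢t : ∀ {v} → v ∈ ⁅ a , b , c ⁆ → v ≢ t
    ≢t v∈ refl = t∉ v∈
  ...     | yes c~t with Adj? G a c | Adj? G b c
  ...       | yes a~c | _ = inj₁ (reach-by-jump G a≢c a∈⁅,,⁆ c∈⁅,,⁆ a~c t∉ c~t)
  ...       | no _ | yes b~c = inj₁ (reach-by-jump G b≢c b∈⁅,,⁆ c∈⁅,,⁆ b~c t∉ c~t)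
  ...       | no a≁c | no b≁c = pendant-case G α≤2 a≢b a≢c b≢c a~b t∉ t≁a t≁b a≁c b≁c c~t

  reach-from-three : ∀ {a b c} → a ≢ b → a ≢ c → b ≢ c → ∀ t →
    Reachable G ⁅ a , b , c ⁆ t ⊎ ConditionStar G
  reach-from-three {a} {b} {c} a≢b a≢c b≢c t with α≤2 a≢b a≢c b≢c
  ... | inj₁ a~b = reach-from-edge a≢b a≢c b≢c a~b t
  ... | inj₂ (inj₁ a~c) rewrite ⁅,,⁆-swap₂₃ {a = a} b≢c = reach-from-edge a≢c a≢b (≢-sym b≢c) a~c t
  ... | inj₂ (inj₂ b~c) rewrite ⁅,,⁆-rotate a≢b a≢c = reach-from-edge b≢c (≢-sym a≢b) (≢-sym a≢c) b~c t

  α≤2⇒AllReach3 : ¬ ConditionStar G → AllReach G 3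
  α≤2⇒AllReach3 ¬∗ D ∣D∣≡3 t with ∣p∣≡3⇒⁅,,⁆ {p = D} ∣D∣≡3
  ... | a , b , c , a≢b , a≢c , b≢c , refl = [ id , ⊥-elim ∘ ¬∗ ]′ (reach-from-three a≢b a≢c b≢c t)

-- Condition (∗) rules out P(G) = 3

atMostOneAdj-⁅,,⁆ : ∀ (G : Graph n) {w v₁ v₂ v₃ p q} → AtMostOneAdj G w v₁ v₂ v₃ →
  p ∈ ⁅ v₁ , v₂ , v₃ ⁆ → q ∈ ⁅ v₁ , v₂ , v₃ ⁆ → p ≢ q → ¬ (Adj G w p × Adj G w q)
atMostOneAdj-⁅,,⁆ G (¬12 , ¬13 , ¬23) p∈ q∈ p≢q (w~p , w~q) with ∈⁅,,⁆⁻ p∈ | ∈⁅,,⁆⁻ q∈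
... | inj₁ refl        | inj₁ refl        = p≢q refl
... | inj₁ refl        | inj₂ (inj₁ refl) = ¬12 (w~p , w~q)
... | inj₁ refl        | inj₂ (inj₂ refl) = ¬13 (w~p , w~q)
... | inj₂ (inj₁ refl) | inj₁ refl        = ¬12 (w~q , w~p)
... | inj₂ (inj₁ refl) | inj₂ (inj₁ refl) = p≢q refl
... | inj₂ (inj₁ refl) | inj₂ (inj₂ refl) = ¬23 (w~p , w~q)
... | inj₂ (inj₂ refl) | inj₁ refl        = ¬13 (w~q , w~p)
... | inj₂ (inj₂ refl) | inj₂ (inj₁ refl) = ¬23 (w~q , w~p)
... | inj₂ (inj₂ refl) | inj₂ (inj₂ refl) = p≢q refl

module _ (G : Graph n) {C D : Subset n} (D-clique : Clique G D) (cover : C ∪ D ≡ ⊤)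
         {t v₁ v₂ v₃ : Fin n} (v₁∈ : v₁ ∈ D) (v₂∈ : v₂ ∈ D) (v₃∈ : v₃ ∈ D)
         (v₁≢v₂ : v₁ ≢ v₂) (v₁≢v₃ : v₁ ≢ v₃) (v₂≢v₃ : v₂ ≢ v₃)
         (t-far : ∀ x → x ∈ D → ¬ Adj G t x) (atMostOne : ∀ c → c ∈ C → AtMostOneAdj G c v₁ v₂ v₃) where

  private
    T : Subset n
    T = ⁅ v₁ , v₂ , v₃ ⁆

    T⊆D : ∀ {x} → x ∈ T → x ∈ D
    T⊆D x∈ with ∈⁅,,⁆⁻ x∈
    ... | inj₁ refl = v₁∈
    ... | inj₂ (inj₁ refl) = v₂∈
    ... | inj₂ (inj₂ refl) = v₃∈

    t∉D : t ∉ D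
    t∉D t∈ with t ≟ v₁
    ... | yes refl = t-far v₂ v₂∈ (D-clique t v₂ t∈ v₂∈ v₁≢v₂)
    ... | no t≢v₁ = t-far v₁ v₁∈ (D-clique t v₁ t∈ v₁∈ t≢v₁)

    T≁t : ∀ {x} → x ∈ T → ¬ Adj G x t
    T≁t x∈ x~t = t-far _ (T⊆D x∈) (Adj-sym G x~t)

    t∉jump : ∀ {u v w} → v ∈ T → Adj G v w → t ∉ jump T u v w
    t∉jump v∈ v~w t∈ with ∈-jump⁻ t∈
    ... | inj₁ refl = T≁t v∈ v~w
    ... | inj₂ (t∈T , _) = t∉D (T⊆D t∈T)

  -- Each jump removes a peg, so after two jumps the single remaining peg cannot move.
  star₃-unreachable : ¬ Reachable G ⁅ v₁ , v₂ , v₃ ⁆ t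
  star₃-unreachable (_ , ε , t∈) = t∉D (T⊆D t∈)
  star₃-unreachable (_ , (_ , _ , _ , _ , _ , v∈ , _ , _ , v~w , refl) ◅ ε , t∈) = t∉jump v∈ v~w t∈
  star₃-unreachable (_ , m₁@(u , v , w , _ , _ , v∈ , _ , _ , v~w , refl)
                       ◅ m₂@(u′ , v′ , _ , u′≢v′ , u′∈ , v′∈ , u′~v′ , _ , v′~t , refl) ◅ rest , t∈)
    with ∈-jump⁻ (stuck⇒Reach⊆ G (∣∣≡1⇒¬PegMove G ∣D₂∣≡1) (_ , rest , t∈))
    where
    ∣D₂∣≡1 : ∣ jump (jump T u v w) u′ v′ _ ∣ ≡ 1
    ∣D₂∣≡1 = suc-injective (suc-injective (trans
      (sym (trans (PegMove⇒∣∣ G m₁) (cong suc (PegMove⇒∣∣ G m₂))))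
      (∣⁅,,⁆∣ {a = v₁} v₁≢v₂ v₁≢v₃ v₂≢v₃)))
  ... | inj₂ (t∈D₁ , _) = t∉jump v∈ v~w t∈D₁
  ... | inj₁ refl with ∈-jump⁻ v′∈
  ...   | inj₂ (v′∈T , _) = T≁t v′∈T v′~t
  ...   | inj₁ refl with ∈-jump⁻ u′∈ | x∈p∪q⁻ C D (subst (w ∈_) (sym cover) ∈⊤)
  ...     | inj₁ u′≡w | _ = u′≢v′ u′≡w
  ...     | inj₂ _ | inj₂ w∈D = t-far w w∈D (Adj-sym G v′~t)
  ...     | inj₂ (u′∈T , _ , u′≢v) | inj₁ w∈C =
    atMostOneAdj-⁅,,⁆ G (atMostOne w w∈C) u′∈T v∈ u′≢v (Adj-sym G u′~v′ , Adj-sym G v~w)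

  star₃⇒¬AllReach3 : ¬ AllReach G 3
  star₃⇒¬AllReach3 allReach =
    star₃-unreachable (allReach ⁅ v₁ , v₂ , v₃ ⁆ (∣⁅,,⁆∣ v₁≢v₂ v₁≢v₃ v₂≢v₃) t)

ConditionStar⇒P≢3 : ∀ (G : Graph n) → ConditionStar G → ¬ PeggingNumberIs G 3
ConditionStar⇒P≢3 G (_ , _ , _ , _ , _ , inj₁ G≅2K₁) (_ , _ , minimal) =
  minimal 2 (s≤s z≤n) ≤-refl (subst (AllReach G) (≅⇒≡ G 2K₁ G≅2K₁) (AllReach-all G))
ConditionStar⇒P≢3 G (_ , _ , _ , _ , _ , inj₂ (inj₁ G≅2K₂)) (_ , allReach3 , _) =
  ≅2K₂⇒¬AllReach3 G G≅2K₂ allReach3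
ConditionStar⇒P≢3 G (_ , _ , _ , D-clique , cover ,
                     inj₂ (inj₂ (_ , _ , _ , _ , _ , v₁∈ , v₂∈ , v₃∈ , v₁≢v₂ , v₁≢v₃ , v₂≢v₃ , t-far , atMostOne)))
                   (_ , allReach3 , _) =
  star₃⇒¬AllReach3 G D-clique cover v₁∈ v₂∈ v₃∈ v₁≢v₂ v₁≢v₃ v₂≢v₃ t-far atMostOne allReach3

module _ (G : Graph n) where

  P≡3-intro : AllReach G 3 → ¬ AllReach G 1 → ¬ AllReach G 2 → PeggingNumberIs G 3
  P≡3-intro allReach3 ¬allReach1 ¬allReach2 = s≤s z≤n , allReach3 , below
    where
    below : ∀ d → 0 < d → d < 3 → ¬ AllReach G d
    below 1 _ _ = ¬allReach1
    below 2 _ _ = ¬allReach2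
    below (suc (suc (suc _))) _ (s≤s (s≤s (s≤s ())))

  independentTriple⇒≅3K₁ : ∀ {x y z} → AllReach G 3 → IndependentTriple G x y z → G ≅ 3K₁
  independentTriple⇒≅3K₁ {x} {y} {z} allReach3 (x≢y , x≢z , y≢z , x≁y , x≁z , y≁z) =
    subst (λ k → G ≅ emptyGraph k) ∣T∣≡3 (covering-independent⇒≅emptyGraph G cover indep)
    where
    ∣T∣≡3 : ∣ ⁅ x , y , z ⁆ ∣ ≡ 3
    ∣T∣≡3 = ∣⁅,,⁆∣ x≢y x≢z y≢z
    indep : Independent G ⁅ x , y , z ⁆
    indep = independent-⁅,,⁆ G x≁y x≁z y≁z
    cover : ∀ v → v ∈ ⁅ x , y , z ⁆
    cover v with v ∈? ⁅ x , y , z ⁆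
    ... | yes v∈ = v∈
    ... | no v∉ = ⊥-elim (independent⇒¬AllReach G indep v∉ (subst (AllReach G) (sym ∣T∣≡3) allReach3))

  ≅3K₁⇒P≡3 : G ≅ 3K₁ → PeggingNumberIs G 3
  ≅3K₁⇒P≡3 G≅3K₁ with ≅⇒≡ G 3K₁ G≅3K₁
  ... | refl = P≡3-intro (AllReach-all G) (twoVertices⇒¬AllReach1 G {0F} {1F} λ ())
    (nonAdjacentPair⇒¬AllReach2 G {0F} {1F} (λ ()) (≅emptyGraph⇒¬Adj G G≅3K₁) (∉⟅,⟆ {a = 0F} {1F} {2F} (λ ()) (λ ())))

  coveringPair⇒ConditionStar : ∀ {x y} → x ≢ y → ¬ Adj G x y → (∀ v → v ∈ ⟅ x , y ⟆) → ConditionStar G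
  coveringPair⇒ConditionStar {x} {y} x≢y x≁y cover =
    Subset.⁅ x ⁆ , Subset.⁅ y ⁆ , singleton-clique , singleton-clique , ⊆-antisym ⊆⊤ ⊤⊆ ,
    inj₁ (subst (λ k → G ≅ emptyGraph k) (∣⟅,⟆∣ x≢y)
      (covering-independent⇒≅emptyGraph G cover (independent-⟅,⟆ G x≁y)))
    where
    singleton-clique : ∀ {w} → Clique G Subset.⁅ w ⁆
    singleton-clique {w} u v u∈ v∈ u≢v = ⊥-elim (u≢v (trans (x∈⁅y⁆⇒x≡y w u∈) (sym (x∈⁅y⁆⇒x≡y w v∈))))
    ⊤⊆ : ⊤ ⊆ Subset.⁅ x ⁆ ∪ Subset.⁅ y ⁆
    ⊤⊆ {v} _ with ∈⟅,⟆⁻ (cover v)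
    ... | inj₁ refl = x∈p∪q⁺ (inj₁ (x∈⁅x⁆ v))
    ... | inj₂ refl = x∈p∪q⁺ (inj₂ (x∈⁅x⁆ v))

  α≡2⇒P≡3 : IndependenceNumberIs G 2 → ¬ ConditionStar G → PeggingNumberIs G 3
  α≡2⇒P≡3 α≡2 ¬∗ with α≡2⇒nonAdjacentPair G α≡2
  ... | x , y , x≢y , x≁y =
    P≡3-intro (α≤2⇒AllReach3 G (α≡2⇒α≤2 G α≡2) ¬∗) (twoVertices⇒¬AllReach1 G x≢y) ¬allReach2
    where
    ¬allReach2 : ¬ AllReach G 2
    ¬allReach2 with any? (λ z → ¬? (z ∈? ⟅ x , y ⟆))
    ... | yes (z , z∉) = nonAdjacentPair⇒¬AllReach2 G x≢y x≁y z∉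
    ... | no none = ⊥-elim (¬∗ (coveringPair⇒ConditionStar x≢y x≁y cover))
      where
      cover : ∀ v → v ∈ ⟅ x , y ⟆
      cover v with v ∈? ⟅ x , y ⟆
      ... | yes v∈ = v∈
      ... | no v∉ = ⊥-elim (none (v , v∉))

corollary6p3 : ∀ {n : ℕ} (G : Graph n) →
    PeggingNumberIs G 3 ⇔ (G ≅ 3K₁ ⊎ (IndependenceNumberIs G 2 × ¬ ConditionStar G))
corollary6p3 G = mk⇔ forward backward
  where
  forward : PeggingNumberIs G 3 → G ≅ 3K₁ ⊎ (IndependenceNumberIs G 2 × ¬ ConditionStar G)
  forward P≡3@(_ , allReach3 , minimal) with independentTriple⊎α≤2 G
  ... | inj₁ (_ , _ , _ , triple) = inj₁ (independentTriple⇒≅3K₁ G allReach3 triple)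
  ... | inj₂ α≤2 with ¬AllReach2⇒nonAdjacentPair G (minimal 2 (s≤s z≤n) ≤-refl)
  ...   | _ , _ , x≢y , x≁y = inj₂ (nonAdjacentPair⇒α≡2 G x≢y x≁y α≤2 , λ ∗ → ConditionStar⇒P≢3 G ∗ P≡3)
  backward : G ≅ 3K₁ ⊎ (IndependenceNumberIs G 2 × ¬ ConditionStar G) → PeggingNumberIs G 3
  backward (inj₁ G≅3K₁) = ≅3K₁⇒P≡3 G G≅3K₁
  backward (inj₂ (α≡2 , ¬∗)) = α≡2⇒P≡3 G α≡2 ¬∗
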